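{- Let $G$ be a graph on vertex set $\{1,\dots,n\}$, let $\phi$ be an automorphism of $G$ of order $p^N$ for a prime $p$ and integer $N>0$, and let $M$ be an $n\times n$ automorphism compatible matrix on $G$. Let $r$ be the number of orbits of $\phi$ of length $p^N$, $\mathcal{T}_0=(v_1,\dots,v_r)$ an ordered transversal of these orbits, $\mathcal{T}_m=(\phi^m(v_1),\dots,\phi^m(v_r))$, $\tilde{\mathcal{T}}_s=\mathcal{T}_{sp^{N-1}}\cup\cdots\cup\mathcal{T}_{sp^{N-1}+p^{N-1}-1}$ for $s=0,\dots,p-1$, and $\mathcal{T}_F=\{v: |\mathcal{O}_\phi(v)|<p^N\}$. Let $F=M[\mathcal{T}_F,\mathcal{T}_F]$, $H=M[\mathcal{T}_F,\tilde{\mathcal{T}}_0]$, $L=M[\tilde{\mathcal{T}}_0,\mathcal{T}_F]$, $D_s=M[\tilde{\mathcal{T}}_0,\tilde{\mathcal{T}}_s]$, $B_0=\sum_{s=0}^{p-1}D_s$, and \[ \tilde M=\begin{bmatrix}F & pH\\ L & B_0\end{bmatrix}, \] a square matrix whose rows and columns are indexed by $\mathcal{T}_F\cup\tilde{\mathcal{T}}_0$. Then there exists an automorphism $\psi$ of $\tilde M$ of order $p^{N-1}$, i.e. a permutation $\psi$ of $\mathcal{T}_F\cup\tilde{\mathcal{T}}_0$ of order $p^{N-1}$ with $\tilde M(\psi(i),\psi(j))=\tilde M(i,j)$ for all indices $i,j$.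
   Context: An automorphism of a graph $G$ is a bijection of $V(G)$ preserving adjacency (and edge weights, if weighted). An $n\times n$ matrix $M$ is automorphism compatible on $G$ if $M_{\phi(i),\phi(j)}=M_{i,j}$ for every automorphism $\phi$ of $G$ and all $i,j$. $\mathcal{O}_\phi(v)=\{\phi^j(v):j\ge0\}$. $M[X,Y]$ denotes the submatrix with rows indexed by $X$ and columns by $Y$. -}

module Defs where

open import Level using (Level; _⊔_)
open import Data.Nat using (ℕ; zero; suc; _+_; _*_; _<_; _∸_; _^_)
open import Data.Fin using (Fin; toℕ)
open import Data.Fin.Permutation using (Permutation′; _⟨$⟩ʳ_)
open import Data.Bool using (Bool; true)
open import Data.Product using (Σ; ∃; _×_; _,_)
open import Data.Sum using (_⊎_; inj₁; inj₂)
open import Relation.Binary.PropositionalEquality using (_≡_)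
open import Relation.Nullary using (¬_)
open import Function.Definitions using (Injective)
open import Algebra.Bundles using (CommutativeRing)

iter : ∀ {a} {A : Set a} → (A → A) → ℕ → A → A
iter f zero x = x
iter f (suc k) x = f (iter f k x)

HasOrder : ∀ {a} {A : Set a} → (A → A) → ℕ → Set a
HasOrder {A = A} f k =
  (0 < k) × (∀ x → iter f k x ≡ x) × (∀ j → 0 < j → j < k → ¬ (∀ x → iter f j x ≡ x))

record Graph (n : ℕ) : Set where
  field
    adj   : Fin n → Fin n → Bool
    sym   : ∀ i j → adj i j ≡ adj j i
    loopless : ∀ i → ¬ (adj i i ≡ true)
open Graph public

IsAutomorphism : ∀ {n} → Graph n → Permutation′ n → Set
IsAutomorphism G φ = ∀ i j → adj G (φ ⟨$⟩ʳ i) (φ ⟨$⟩ʳ j) ≡ adj G i j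

module _ {c ℓ} (R : CommutativeRing c ℓ) where
  open CommutativeRing R using (Carrier; _≈_; 0#) renaming (_+_ to _+R_)

  Matrix : ℕ → ℕ → Set c
  Matrix m k = Fin m → Fin k → Carrier

  AutCompatible : ∀ {n} → Graph n → Matrix n n → Set ℓ
  AutCompatible {n} G M = ∀ (φ : Permutation′ n) → IsAutomorphism G φ →
    ∀ i j → M (φ ⟨$⟩ʳ i) (φ ⟨$⟩ʳ j) ≈ M i j

  sumTo : ℕ → (ℕ → Carrier) → Carrier
  sumTo zero f = 0#
  sumTo (suc k) f = sumTo k f +R f k

  nmul : ℕ → Carrier → Carrier
  nmul zero x = 0#
  nmul (suc k) x = x +R nmul k x

-- |O_φ(v)| = k : e enumerates the orbit {φ^j(v) : j ≥ 0} without repetition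
OrbitCard : ∀ {n} → Permutation′ n → Fin n → ℕ → Set
OrbitCard {n} φ v k =
  Σ (Fin k → Fin n) λ e →
    Injective _≡_ _≡_ e
    × (∀ i → ∃ λ j → iter (φ ⟨$⟩ʳ_) j v ≡ e i)
    × (∀ j → ∃ λ i → e i ≡ iter (φ ⟨$⟩ʳ_) j v)

-- Index set  T_F ∪ T̃_0  of the reduced matrix M̃:
--   inj₁ (u , _)   : u ∈ T_F
--   inj₂ (i , m)   : the vertex φ^m(v_i)  (i < r, m < q = p^(N-1)), i.e. the i-th entry of T_m
Index : ∀ {n} → (Fin n → Bool) → ℕ → ℕ → Set
Index {n} TF r q = (Σ (Fin n) λ u → TF u ≡ true) ⊎ (Fin r × Fin q)

module _ {c ℓ} (R : CommutativeRing c ℓ) where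
  open CommutativeRing R using (Carrier; _≈_; 0#) renaming (_+_ to _+R_)

  -- M̃ = [ F  pH ; L  B_0 ],  q = p^(N-1), B_0 = Σ_{s<p} D_s,
  -- D_s[(i,m),(j,m')] = M(φ^m v_i , φ^(s q + m') v_j)
  Mtilde : ∀ {n} → Permutation′ n → (p q : ℕ) → (TF : Fin n → Bool) → (r : ℕ) →
           (Fin r → Fin n) → Matrix R n n → Index TF r q → Index TF r q → Carrier
  Mtilde φ p q TF r v M (inj₁ (u , _)) (inj₁ (u′ , _)) = M u u′
  Mtilde φ p q TF r v M (inj₁ (u , _)) (inj₂ (j , m′)) =
    nmul R p (M u (iter (φ ⟨$⟩ʳ_) (toℕ m′) (v j)))
  Mtilde φ p q TF r v M (inj₂ (i , m)) (inj₁ (u′ , _)) =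
    M (iter (φ ⟨$⟩ʳ_) (toℕ m) (v i)) u′
  Mtilde φ p q TF r v M (inj₂ (i , m)) (inj₂ (j , m′)) =
    sumTo R p (λ s → M (iter (φ ⟨$⟩ʳ_) (toℕ m) (v i))
                       (iter (φ ⟨$⟩ʳ_) (s * q + toℕ m′) (v j)))

-- Put q = p^(N-1). A vertex outside the full orbits has a minimal period that is a proper
-- divisor of p^N, hence divides q, so φ^q fixes T_F pointwise. Let ψ act as φ on T_F and as
-- m ↦ m + 1 (mod q) on the T_m-index of T̃_0. Moving both indices of an entry of M̃ one step
-- along φ preserves it because M is φ-invariant; the reduction mod q is harmless because
-- the rows and columns of M through a point of T_F are q-periodic, and because each entry
-- of B_0 sums M over a whole φ-orbit of length p·q in steps of q, so a shift by q only
-- rotates the p summands. ψ^q = id, and no smaller power is the identity since ψ rotates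
-- T̃_0, which is nonempty: if every orbit were short, φ^q would already be the identity.
module Submission where

open import Defs hiding (sym)
open import Data.Nat
  using ( ℕ; zero; suc; pred; _+_; _*_; _∸_; _^_; _<_; _≤_; _%_; _/_; _<?_
        ; NonZero; >-nonZero; >-nonZero⁻¹; nonTrivial⇒n>1; z<s )
open import Data.Nat.Properties
  using ( +-comm; +-assoc; +-suc; +-identityʳ; *-comm; *-identityˡ; *-identityʳ
        ; <-cmp; <-irrefl; <⇒≤; ≤-<-trans; m<n⇒0<n∸m; m∸n≤m; m+[n∸m]≡n; n<1+n
        ; m^n≢0; m^n>0; ^-monoʳ-<; suc-pred )
open import Data.Nat.DivMod
  using (_mod_; m≡m%n+[m/n]*n; m%n<n; m%n%n≡m%n; [m+n]%n≡m%n; m<n⇒m%n≡m; %-distribˡ-+)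
open import Data.Nat.Divisibility
  using (_∣_; divides; _∣?_; ∣-trans; ∣-refl; ∣-reflexive; *-pres-∣; *-cancelˡ-∣; ∣1⇒≡1; m%n≡0⇒n∣m)
open import Data.Nat.Coprimality using (Coprime; coprime-divisor)
open import Data.Nat.Primality using (Prime; prime⇒nonZero; prime⇒nonTrivial; prime⇒irreducible)
open import Data.Bool using (Bool; true)
import Data.Bool.Properties as Bool
open import Data.Fin as Fin using (Fin; toℕ; fromℕ; fromℕ<)
open import Data.Fin.Properties
  using (toℕ-injective; toℕ-fromℕ; toℕ-fromℕ<; toℕ-inject; toℕ<n; injective⇒≤; ¬∀⟶∃¬-smallest; ¬Fin0)
open import Data.Fin.Permutation using (Permutation′; _⟨$⟩ʳ_)
open import Data.Product using (Σ; ∃; ∃-syntax; _×_; _,_; proj₁; proj₂)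
open import Data.Product.Properties using (,-injectiveʳ)
open import Data.Sum using (inj₁; inj₂)
open import Data.Sum.Properties using (inj₂-injective)
open import Data.Empty using (⊥-elim)
open import Function.Base using (_∘_; id)
open import Function.Bundles using (_↔_; Inverse; Injection; mk↔ₛ′)
open import Function.Definitions using (Injective)
open import Function.Properties.Inverse using (↔⇒↣)
open import Algebra.Bundles using (CommutativeRing)
open import Axiom.UniquenessOfIdentityProofs using (module Decidable⇒UIP)
open import Relation.Unary using (Pred)
open import Relation.Binary.Bundles using (Setoid)
open import Relation.Binary.Definitions using (DecidableEquality; tri<; tri≈; tri>)
open import Relation.Nullary using (¬_; Dec; yes; no; ¬?; _×-dec_)
open import Relation.Nullary.Decidable using (decidable-stable)
open import Relation.Binary.PropositionalEquality
  using (_≡_; _≢_; refl; sym; trans; cong; cong₂; subst; module ≡-Reasoning)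

module _ {a} {A : Set a} (f : A → A) where

  iter-+ : ∀ m k x → iter f (m + k) x ≡ iter f m (iter f k x)
  iter-+ zero    k x = refl
  iter-+ (suc m) k x = cong f (iter-+ m k x)

  iter-comm : ∀ k x → iter f k (f x) ≡ f (iter f k x)
  iter-comm zero    x = refl
  iter-comm (suc k) x = cong f (iter-comm k x)

  iter-injective : Injective _≡_ _≡_ f → ∀ k → Injective _≡_ _≡_ (iter f k)
  iter-injective inj zero    eq = eq
  iter-injective inj (suc k) eq = iter-injective inj k (inj eq)

  iter-*-fixed : ∀ {d x} → iter f d x ≡ x → ∀ t → iter f (t * d) x ≡ x
  iter-*-fixed fixed zero = refl
  iter-*-fixed {d} {x} fixed (suc t) = begin
    iter f (d + t * d) x        ≡⟨ iter-+ d (t * d) x ⟩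
    iter f d (iter f (t * d) x) ≡⟨ cong (iter f d) (iter-*-fixed fixed t) ⟩
    iter f d x                  ≡⟨ fixed ⟩
    x                           ∎
    where open ≡-Reasoning

  iter-%-fixed : ∀ {d x} .{{_ : NonZero d}} → iter f d x ≡ x → ∀ b → iter f b x ≡ iter f (b % d) x
  iter-%-fixed {d} {x} fixed b = begin
    iter f b x                                 ≡⟨ cong (λ k → iter f k x) (m≡m%n+[m/n]*n b d) ⟩
    iter f (b % d + (b / d) * d) x             ≡⟨ iter-+ (b % d) ((b / d) * d) x ⟩
    iter f (b % d) (iter f ((b / d) * d) x)    ≡⟨ cong (iter f (b % d)) (iter-*-fixed fixed (b / d)) ⟩
    iter f (b % d) x                           ∎
    where open ≡-Reasoning

minimal-witness : ∀ {q} {Q : Pred ℕ q} → (∀ j → Dec (Q j)) →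
                  ∀ {n} → Q n → ∃[ d ] (Q d × (∀ {j} → j < d → ¬ Q j))
minimal-witness {Q = Q} Q? {n} Qn
  with ¬∀⟶∃¬-smallest (suc n) (¬_ ∘ Q ∘ toℕ) (¬? ∘ Q? ∘ toℕ)
         (λ none → none (fromℕ n) (subst Q (sym (toℕ-fromℕ n)) Qn))
... | d , ¬¬Qd , below = toℕ d , decidable-stable (Q? (toℕ d)) ¬¬Qd , λ j<d →
  subst (¬_ ∘ Q) (trans (toℕ-inject (fromℕ< j<d)) (toℕ-fromℕ< j<d)) (below (fromℕ< j<d))

module _ {a} {A : Set a} (f : A → A) where

  record IsMinimalPeriod (x : A) (d : ℕ) : Set a where
    field
      positive : 0 < d
      returns  : iter f d x ≡ x
      minimal  : ∀ {j} → 0 < j → j < d → iter f j x ≢ x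

  minimalPeriod : DecidableEquality A → ∀ {P x} → 0 < P → iter f P x ≡ x → ∃ (IsMinimalPeriod x)
  minimalPeriod _≟_ {x = x} 0<P fixed
    with minimal-witness (λ j → (0 <? j) ×-dec (iter f j x ≟ x)) (0<P , fixed)
  ... | d , (0<d , returns) , below = d , record
    { positive = 0<d ; returns = returns ; minimal = λ 0<j j<d eq → below j<d (0<j , eq) }

  module _ {x d} (period : IsMinimalPeriod x d) where
    open IsMinimalPeriod period

    private instance
      d≢0 : NonZero d
      d≢0 = >-nonZero positive

    minimalPeriod-∣ : ∀ {P} → iter f P x ≡ x → d ∣ P
    minimalPeriod-∣ {P} fixed with P % d in eq
    ... | zero  = m%n≡0⇒n∣m P d eq
    ... | suc k = ⊥-elim (minimal z<s (subst (_< d) eq (m%n<n P d))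
                   (trans (cong (λ j → iter f j x) (sym eq)) (trans (sym (iter-%-fixed f returns P)) fixed)))

    private
      no-return-before : Injective _≡_ _≡_ f → ∀ {i j} → i < j → j < d → iter f i x ≢ iter f j x
      no-return-before inj {i} {j} i<j j<d eq =
        minimal (m<n⇒0<n∸m i<j) (≤-<-trans (m∸n≤m j i) j<d) (iter-injective f inj i (begin
          iter f i (iter f (j ∸ i) x) ≡⟨ iter-+ f i (j ∸ i) x ⟨
          iter f (i + (j ∸ i)) x      ≡⟨ cong (λ k → iter f k x) (m+[n∸m]≡n (<⇒≤ i<j)) ⟩
          iter f j x                  ≡⟨ eq ⟨
          iter f i x                  ∎))
        where open ≡-Reasoning

    minimalPeriod-iter-injective : Injective _≡_ _≡_ f → ∀ {i j} → i < d → j < d →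
                                   iter f i x ≡ iter f j x → i ≡ j
    minimalPeriod-iter-injective inj {i} {j} i<d j<d eq with <-cmp i j
    ... | tri< i<j _ _ = ⊥-elim (no-return-before inj i<j j<d eq)
    ... | tri≈ _ i≡j _ = i≡j
    ... | tri> _ _ j<i = ⊥-elim (no-return-before inj j<i i<d (sym eq))

∣p^[1+k]∧≢⇒∣p^k : ∀ {p} → Prime p → ∀ k {d} → d ∣ p ^ suc k → d ≢ p ^ suc k → d ∣ p ^ k
∣p^[1+k]∧≢⇒∣p^k {p} p-prime k {d} d∣ d≢ with p ∣? d
... | no p∤d = coprime-divisor d⊥p d∣
  where
  d⊥p : Coprime d p
  d⊥p (c∣d , c∣p) with prime⇒irreducible p-prime c∣p
  ... | inj₁ c≡1 = c≡1
  ... | inj₂ refl = ⊥-elim (p∤d c∣d)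
... | yes (divides e refl) = ep∣p^k k (*-cancelˡ-∣ p (subst (_∣ p ^ suc k) (*-comm e p) d∣)) d≢
  where
  instance
    p≢0 : NonZero p
    p≢0 = prime⇒nonZero p-prime

  ep∣p^k : ∀ k → e ∣ p ^ k → e * p ≢ p ^ suc k → e * p ∣ p ^ k
  ep∣p^k zero e∣1 ep≢p with ∣1⇒≡1 e∣1
  ... | refl = ⊥-elim (ep≢p (trans (*-identityˡ p) (sym (*-identityʳ p))))
  ep∣p^k (suc k) e∣p^[1+k] ep≢ =
    ∣-trans (*-pres-∣ (∣p^[1+k]∧≢⇒∣p^k p-prime k e∣p^[1+k] e≢) (∣-refl {p}))
            (∣-reflexive (*-comm (p ^ k) p))
    where
    e≢ : e ≢ p ^ suc k
    e≢ eq = ep≢ (trans (cong (_* p) eq) (*-comm (p ^ suc k) p))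

module _ {n} (φ : Permutation′ n) where

  private
    f : Fin n → Fin n
    f = φ ⟨$⟩ʳ_

    φ-injective : Injective _≡_ _≡_ f
    φ-injective = Injection.injective (↔⇒↣ φ)

  minimalPeriod⇒orbitCard : ∀ {x d} → IsMinimalPeriod f x d → OrbitCard φ x d
  minimalPeriod⇒orbitCard {x} {d} period = enum , enum-injective , (λ i → toℕ i , refl) , covers
    where
    open IsMinimalPeriod period
    instance
      d≢0 : NonZero d
      d≢0 = >-nonZero positive

    enum : Fin d → Fin n
    enum i = iter f (toℕ i) x

    enum-injective : Injective _≡_ _≡_ enum
    enum-injective eq =
      toℕ-injective (minimalPeriod-iter-injective f period φ-injective (toℕ<n _) (toℕ<n _) eq)

    covers : ∀ j → ∃ λ i → enum i ≡ iter f j x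
    covers j = j mod d , trans (cong (λ k → iter f k x) (toℕ-fromℕ< (m%n<n j d)))
                               (sym (iter-%-fixed f returns j))

  minimalPeriod≤orbitCard : ∀ {x d k} → IsMinimalPeriod f x d → OrbitCard φ x k → d ≤ k
  minimalPeriod≤orbitCard {x} period (enum , _ , _ , covers) = injective⇒≤ index-injective
    where
    index : Fin _ → Fin _
    index i = proj₁ (covers (toℕ i))

    index-injective : Injective _≡_ _≡_ index
    index-injective {i} {j} eq =
      toℕ-injective (minimalPeriod-iter-injective f period φ-injective (toℕ<n i) (toℕ<n j) (begin
        iter f (toℕ i) x   ≡⟨ proj₂ (covers (toℕ i)) ⟨
        enum (index i)     ≡⟨ cong enum eq ⟩
        enum (index j)     ≡⟨ proj₂ (covers (toℕ j)) ⟩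
        iter f (toℕ j) x   ∎))
      where open ≡-Reasoning

  orbitCard-step : ∀ {x k} m → iter f (suc m) x ≡ x → OrbitCard φ x k → OrbitCard φ (f x) k
  orbitCard-step {x} m returns (enum , enum-injective , reaches , covers) =
    enum , enum-injective , reaches′ , covers′
    where
    covers′ : ∀ j → ∃ λ i → enum i ≡ iter f j (f x)
    covers′ j = subst (λ y → ∃ λ i → enum i ≡ y) (sym (iter-comm f j x)) (covers (suc j))

    reaches′ : ∀ i → ∃ λ j → iter f j (f x) ≡ enum i
    reaches′ i with reaches i
    ... | j , eq = j + m , (begin
      iter f (j + m) (f x)     ≡⟨ iter-+ f j m (f x) ⟩
      iter f j (iter f m (f x)) ≡⟨ cong (iter f j) (trans (iter-comm f m x) returns) ⟩
      iter f j x               ≡⟨ eq ⟩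
      enum i                   ∎)
      where open ≡-Reasoning

module _ {c ℓ} (S : Setoid c ℓ) where
  open Setoid S using (Carrier; _≈_)
  private module ≈ = Setoid S

  periodic⇒≈% : ∀ {q} .{{_ : NonZero q}} (h : ℕ → Carrier) →
                (∀ b → h (b + q) ≈ h b) → ∀ b → h (b % q) ≈ h b
  periodic⇒≈% {q} h periodic b =
    ≈.sym (≈.trans (≈.reflexive (cong h (m≡m%n+[m/n]*n b q))) (drop (b % q) (b / q)))
    where
    drop : ∀ a t → h (a + t * q) ≈ h a
    drop a zero    = ≈.reflexive (cong h (+-identityʳ a))
    drop a (suc t) =
      ≈.trans (≈.reflexive (cong h (trans (cong (a +_) (+-comm q (t * q))) (sym (+-assoc a (t * q) q)))))
              (≈.trans (periodic (a + t * q)) (drop a t))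

  module _ (h : ℕ → ℕ → Carrier) (diagonal : ∀ a b → h (suc a) (suc b) ≈ h a b) where

    diagonal-+ : ∀ k a b → h (k + a) (k + b) ≈ h a b
    diagonal-+ zero    a b = ≈.refl
    diagonal-+ (suc k) a b = ≈.trans (diagonal (k + a) (k + b)) (diagonal-+ k a b)

    periodicʳ⇒periodicˡ : ∀ {q} → (∀ a b → h a (b + q) ≈ h a b) → ∀ a b → h (a + q) b ≈ h a b
    periodicʳ⇒periodicˡ {q} periodicʳ a b =
      ≈.trans (≈.sym (periodicʳ (a + q) b))
            (≈.trans (≈.reflexive (cong₂ h (+-comm a q) (+-comm b q))) (diagonal-+ q a b))

hasOrder⇒↔ : ∀ {a} {A : Set a} {f : A → A} {k} → HasOrder f k → A ↔ A
hasOrder⇒↔ {f = f} {k} (0<k , fᵏ≡id , _) = mk↔ₛ′ f (iter f (pred k)) f∘fᵏ⁻¹≡id fᵏ⁻¹∘f≡id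
  where
  instance
    k≢0 : NonZero k
    k≢0 = >-nonZero 0<k

  f∘fᵏ⁻¹≡id : ∀ x → f (iter f (pred k) x) ≡ x
  f∘fᵏ⁻¹≡id x = trans (cong (λ j → iter f j x) (suc-pred k)) (fᵏ≡id x)

  fᵏ⁻¹∘f≡id : ∀ x → iter f (pred k) (f x) ≡ x
  fᵏ⁻¹∘f≡id x = trans (iter-comm f (pred k) x) (f∘fᵏ⁻¹≡id x)

module _ {n} (φ : Permutation′ n) {p} (p-prime : Prime p) (N : ℕ)
         (order : HasOrder (φ ⟨$⟩ʳ_) (p ^ suc N)) where

  private
    f : Fin n → Fin n
    f = φ ⟨$⟩ʳ_

    instance
      p≢0 : NonZero p
      p≢0 = prime⇒nonZero p-prime

    0<pᴺ⁺¹ : 0 < p ^ suc N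
    0<pᴺ⁺¹ = proj₁ order

    fᴾ≡id : ∀ x → iter f (p ^ suc N) x ≡ x
    fᴾ≡id = proj₁ (proj₂ order)

  minimalPeriod≢⇒fixed : ∀ {x d} → IsMinimalPeriod f x d → d ≢ p ^ suc N → iter f (p ^ N) x ≡ x
  minimalPeriod≢⇒fixed {x} period d≢
    with ∣p^[1+k]∧≢⇒∣p^k p-prime N (minimalPeriod-∣ f period (fᴾ≡id x)) d≢
  ... | divides t eq = trans (cong (λ j → iter f j x) eq) (iter-*-fixed f (IsMinimalPeriod.returns period) t)

  minimalPeriodOf : ∀ x → ∃ (IsMinimalPeriod f x)
  minimalPeriodOf x = minimalPeriod f Fin._≟_ 0<pᴺ⁺¹ (fᴾ≡id x)

  short-orbit⇒fixed : ∀ {x k} → OrbitCard φ x k → k < p ^ suc N → iter f (p ^ N) x ≡ x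
  short-orbit⇒fixed {x} card k<P with minimalPeriodOf x
  ... | d , period = minimalPeriod≢⇒fixed period λ d≡P →
    <-irrefl d≡P (≤-<-trans (minimalPeriod≤orbitCard φ period card) k<P)

  some-orbit-full : ¬ (∀ x → ¬ OrbitCard φ x (p ^ suc N))
  some-orbit-full no-full-orbit = proj₂ (proj₂ order) (p ^ N) (m^n>0 p N) pᴺ<pᴺ⁺¹ fixed
    where
    pᴺ<pᴺ⁺¹ : p ^ N < p ^ suc N
    pᴺ<pᴺ⁺¹ = ^-monoʳ-< p (nonTrivial⇒n>1 p {{prime⇒nonTrivial p-prime}}) (n<1+n N)

    fixed : ∀ x → iter f (p ^ N) x ≡ x
    fixed x with minimalPeriodOf x
    ... | d , period = minimalPeriod≢⇒fixed period λ d≡P →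
      no-full-orbit x (subst (OrbitCard φ x) d≡P (minimalPeriod⇒orbitCard φ period))

  orbitCard-φ : ∀ {x k} → OrbitCard φ x k → OrbitCard φ (f x) k
  orbitCard-φ {x} = orbitCard-step φ (pred (p ^ suc N))
    (trans (cong (λ j → iter f j x) (suc-pred (p ^ suc N) {{>-nonZero 0<pᴺ⁺¹}})) (fᴾ≡id x))

  transversal-nonempty : ∀ {r} (v : Fin r → Fin n) →
    (∀ w → OrbitCard φ w (p ^ suc N) → ∃[ i ] ∃[ k ] (iter f k (v i) ≡ w)) → 0 < r
  transversal-nonempty {zero}  v meets = ⊥-elim (some-orbit-full λ w card → ¬Fin0 (proj₁ (meets w card)))
  transversal-nonempty {suc r} v meets = z<s

module _ {c ℓ} (R : CommutativeRing c ℓ) where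
  open CommutativeRing R
    using (Carrier; _≈_; 0#)
    renaming (_+_ to _+R_)
  private module ≈ = CommutativeRing R
  open import Algebra.Properties.Ring ≈.ring using (+-cancelʳ)
  open import Relation.Binary.Reasoning.Setoid ≈.setoid

  sumTo-cong : ∀ k {g h : ℕ → Carrier} → (∀ s → g s ≈ h s) → sumTo R k g ≈ sumTo R k h
  sumTo-cong zero    g≈h = ≈.refl
  sumTo-cong (suc k) g≈h = ≈.+-cong (sumTo-cong k g≈h) (g≈h k)

  nmul-cong : ∀ k {x y} → x ≈ y → nmul R k x ≈ nmul R k y
  nmul-cong zero    x≈y = ≈.refl
  nmul-cong (suc k) x≈y = ≈.+-cong x≈y (nmul-cong k x≈y)

  sumTo-suc : ∀ k (h : ℕ → Carrier) → sumTo R (suc k) h ≈ h 0 +R sumTo R k (h ∘ suc)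
  sumTo-suc zero    h = ≈.+-comm 0# (h 0)
  sumTo-suc (suc k) h = ≈.trans (≈.+-congʳ (sumTo-suc k h)) (≈.+-assoc (h 0) _ _)

  sumTo-rotate : ∀ k (h : ℕ → Carrier) → h k ≈ h 0 → sumTo R k (h ∘ suc) ≈ sumTo R k h
  sumTo-rotate k h hₖ≈h₀ = +-cancelʳ (h 0) _ _ (begin
    sumTo R k (h ∘ suc) +R h 0   ≈⟨ ≈.+-comm _ (h 0) ⟩
    h 0 +R sumTo R k (h ∘ suc)   ≈⟨ sumTo-suc k h ⟨
    sumTo R k h +R h k           ≈⟨ ≈.+-congˡ hₖ≈h₀ ⟩
    sumTo R k h +R h 0           ∎)

module _ (q : ℕ) .{{_ : NonZero q}} where

  rotate : Fin q → Fin q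
  rotate m = suc (toℕ m) mod q

  toℕ-rotate : ∀ m → toℕ (rotate m) ≡ suc (toℕ m) % q
  toℕ-rotate m = toℕ-fromℕ< (m%n<n (suc (toℕ m)) q)

  toℕ-iter-rotate : ∀ k m → toℕ (iter rotate k m) ≡ (toℕ m + k) % q
  toℕ-iter-rotate zero m = sym (trans (cong (_% q) (+-identityʳ (toℕ m))) (m<n⇒m%n≡m (toℕ<n m)))
  toℕ-iter-rotate (suc k) m = begin
    toℕ (rotate (iter rotate k m))    ≡⟨ toℕ-rotate (iter rotate k m) ⟩
    suc (toℕ (iter rotate k m)) % q   ≡⟨ cong (λ a → suc a % q) (toℕ-iter-rotate k m) ⟩
    (1 + (toℕ m + k) % q) % q         ≡⟨ %-distribˡ-+ 1 ((toℕ m + k) % q) q ⟩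
    (1 % q + (toℕ m + k) % q % q) % q ≡⟨ cong (λ a → (1 % q + a) % q) (m%n%n≡m%n (toℕ m + k) q) ⟩
    (1 % q + (toℕ m + k) % q) % q     ≡⟨ %-distribˡ-+ 1 (toℕ m + k) q ⟨
    suc (toℕ m + k) % q               ≡⟨ cong (_% q) (+-suc (toℕ m) k) ⟨
    (toℕ m + suc k) % q               ∎
    where open ≡-Reasoning

module _ {n} (φ : Permutation′ n) {TF : Fin n → Bool}
         (TF-closed : ∀ {u} → TF u ≡ true → TF (φ ⟨$⟩ʳ u) ≡ true)
         (r q : ℕ) .{{_ : NonZero q}} where

  private
    f : Fin n → Fin n
    f = φ ⟨$⟩ʳ_

  ψ : Index TF r q → Index TF r q
  ψ (inj₁ (u , u∈TF)) = inj₁ (f u , TF-closed u∈TF)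
  ψ (inj₂ (i , m))    = inj₂ (i , rotate q m)

  TF-iter-closed : ∀ k {u} → TF u ≡ true → TF (iter f k u) ≡ true
  TF-iter-closed zero    = id
  TF-iter-closed (suc k) = TF-closed ∘ TF-iter-closed k

  iter-ψ-inj₁ : ∀ k {u} (u∈TF : TF u ≡ true) →
                iter ψ k (inj₁ (u , u∈TF)) ≡ inj₁ (iter f k u , TF-iter-closed k u∈TF)
  iter-ψ-inj₁ zero    u∈TF = refl
  iter-ψ-inj₁ (suc k) u∈TF = cong ψ (iter-ψ-inj₁ k u∈TF)

  iter-ψ-inj₂ : ∀ k i m → iter ψ k (inj₂ (i , m)) ≡ inj₂ (i , iter (rotate q) k m)
  iter-ψ-inj₂ zero    i m = refl
  iter-ψ-inj₂ (suc k) i m = cong ψ (iter-ψ-inj₂ k i m)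

  inj₁-≡ : ∀ {u w} {u∈TF : TF u ≡ true} {w∈TF : TF w ≡ true} → u ≡ w →
           _≡_ {A = Index TF r q} (inj₁ (u , u∈TF)) (inj₁ (w , w∈TF))
  inj₁-≡ refl = cong (λ u∈TF → inj₁ (_ , u∈TF)) (Decidable⇒UIP.≡-irrelevant Bool._≟_ _ _)

  module _ (TF-fixed : ∀ {u} → TF u ≡ true → iter f q u ≡ u) where

    ψ^q≡id : ∀ x → iter ψ q x ≡ x
    ψ^q≡id (inj₁ (u , u∈TF)) = trans (iter-ψ-inj₁ q u∈TF) (inj₁-≡ (TF-fixed u∈TF))
    ψ^q≡id (inj₂ (i , m)) = trans (iter-ψ-inj₂ q i m) (cong (λ m′ → inj₂ (i , m′)) (toℕ-injective (begin
      toℕ (iter (rotate q) q m) ≡⟨ toℕ-iter-rotate q q m ⟩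
      (toℕ m + q) % q           ≡⟨ [m+n]%n≡m%n (toℕ m) q ⟩
      toℕ m % q                 ≡⟨ m<n⇒m%n≡m (toℕ<n m) ⟩
      toℕ m                     ∎)))
      where open ≡-Reasoning

    ψ-hasOrder : Fin r → HasOrder ψ q
    ψ-hasOrder i = 0<q , ψ^q≡id , λ j 0<j j<q ψʲ≡id → <-irrefl (j≡0 j<q (ψʲ≡id (inj₂ (i , m₀)))) 0<j
      where
      0<q : 0 < q
      0<q = >-nonZero⁻¹ q

      m₀ : Fin q
      m₀ = fromℕ< 0<q

      j≡0 : ∀ {j} → j < q → iter ψ j (inj₂ (i , m₀)) ≡ inj₂ (i , m₀) → 0 ≡ j
      j≡0 {j} j<q ψʲm₀≡m₀ = begin
        0                              ≡⟨ toℕ-fromℕ< 0<q ⟨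
        toℕ m₀                         ≡⟨ cong toℕ rotateʲm₀≡m₀ ⟨
        toℕ (iter (rotate q) j m₀)     ≡⟨ toℕ-iter-rotate q j m₀ ⟩
        (toℕ m₀ + j) % q               ≡⟨ cong (λ a → (a + j) % q) (toℕ-fromℕ< 0<q) ⟩
        j % q                          ≡⟨ m<n⇒m%n≡m j<q ⟩
        j                              ∎
        where
        open ≡-Reasoning
        rotateʲm₀≡m₀ : iter (rotate q) j m₀ ≡ m₀
        rotateʲm₀≡m₀ = ,-injectiveʳ (inj₂-injective (trans (sym (iter-ψ-inj₂ j i m₀)) ψʲm₀≡m₀))

module _ {c ℓ} (R : CommutativeRing c ℓ) {n} (φ : Permutation′ n) (M : Matrix R n n)
         (M-invariant : ∀ a b → CommutativeRing._≈_ R (M (φ ⟨$⟩ʳ a) (φ ⟨$⟩ʳ b)) (M a b))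
         (p q : ℕ) .{{_ : NonZero q}} (period : ∀ x → iter (φ ⟨$⟩ʳ_) (p * q) x ≡ x)
         {TF : Fin n → Bool} (TF-closed : ∀ {u} → TF u ≡ true → TF (φ ⟨$⟩ʳ u) ≡ true)
         (TF-fixed : ∀ {u} → TF u ≡ true → iter (φ ⟨$⟩ʳ_) q u ≡ u)
         (r : ℕ) (v : Fin r → Fin n) where

  open CommutativeRing R using (Carrier; _≈_)

  private
    module ≈ = CommutativeRing R
    open import Relation.Binary.Reasoning.Setoid ≈.setoid

    f : Fin n → Fin n
    f = φ ⟨$⟩ʳ_

    Φ : ℕ → Fin n → Fin n
    Φ = iter f

  M-iter-invariant : ∀ k a b → M (Φ k a) (Φ k b) ≈ M a b
  M-iter-invariant zero    a b = ≈.refl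
  M-iter-invariant (suc k) a b = ≈.trans (M-invariant (Φ k a) (Φ k b)) (M-iter-invariant k a b)

  iter-+q : ∀ b y → Φ (b + q) y ≡ Φ q (Φ b y)
  iter-+q b y = trans (cong (λ k → Φ k y) (+-comm b q)) (iter-+ f q b y)

  M-column-periodic : ∀ {w} → Φ q w ≡ w → ∀ y b → M w (Φ (b + q) y) ≈ M w (Φ b y)
  M-column-periodic {w} fixed y b =
    ≈.trans (≈.reflexive (cong₂ M (sym fixed) (iter-+q b y))) (M-iter-invariant q w (Φ b y))

  M-row-periodic : ∀ {w} → Φ q w ≡ w → ∀ x a → M (Φ (a + q) x) w ≈ M (Φ a x) w
  M-row-periodic {w} fixed x a =
    ≈.trans (≈.reflexive (cong₂ M (iter-+q a x) (sym fixed))) (M-iter-invariant q (Φ a x) w)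

  module _ (x y : Fin n) where

    B-entry : ℕ → ℕ → Carrier
    B-entry a b = sumTo R p (λ s → M (Φ a x) (Φ (s * q + b) y))

    B-entry-diagonal : ∀ a b → B-entry (suc a) (suc b) ≈ B-entry a b
    B-entry-diagonal a b = sumTo-cong R p λ s →
      ≈.trans (≈.reflexive (cong (λ k → M (Φ (suc a) x) (Φ k y)) (+-suc (s * q) b)))
              (M-invariant (Φ a x) (Φ (s * q + b) y))

    B-entry-periodicʳ : ∀ a b → B-entry a (b + q) ≈ B-entry a b
    B-entry-periodicʳ a b =
      ≈.trans (sumTo-cong R p λ s → ≈.reflexive (cong (λ k → M (Φ a x) (Φ k y)) (regroup s)))
              (sumTo-rotate R p (λ s → M (Φ a x) (Φ (s * q + b) y))
                (≈.reflexive (cong (M (Φ a x)) (trans (iter-+ f (p * q) b y) (period (Φ b y))))))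
      where
      regroup : ∀ s → s * q + (b + q) ≡ suc s * q + b
      regroup s = trans (sym (+-assoc (s * q) b q)) (trans (+-comm (s * q + b) q) (sym (+-assoc q (s * q) b)))

    B-entry-periodicˡ : ∀ a b → B-entry (a + q) b ≈ B-entry a b
    B-entry-periodicˡ = periodicʳ⇒periodicˡ ≈.setoid B-entry B-entry-diagonal B-entry-periodicʳ

  Mtilde-ψ-invariant : ∀ i j → Mtilde R φ p q TF r v M (ψ φ TF-closed r q i) (ψ φ TF-closed r q j)
                                ≈ Mtilde R φ p q TF r v M i j
  Mtilde-ψ-invariant (inj₁ (u , _)) (inj₁ (u′ , _)) = M-invariant u u′
  Mtilde-ψ-invariant (inj₁ (u , u∈TF)) (inj₂ (j , m′)) = nmul-cong R p (begin
    M (f u) (Φ (toℕ (rotate q m′)) (v j)) ≡⟨ cong (λ k → M (f u) (Φ k (v j))) (toℕ-rotate q m′) ⟩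
    M (f u) (Φ (suc b % q) (v j))        ≈⟨ periodic⇒≈% ≈.setoid (λ k → M (f u) (Φ k (v j)))
                                              (M-column-periodic (TF-fixed (TF-closed u∈TF)) (v j)) (suc b) ⟩
    M (f u) (Φ (suc b) (v j))            ≈⟨ M-invariant u (Φ b (v j)) ⟩
    M u (Φ b (v j))                      ∎)
    where b = toℕ m′
  Mtilde-ψ-invariant (inj₂ (i , m)) (inj₁ (u′ , u′∈TF)) = begin
    M (Φ (toℕ (rotate q m)) (v i)) (f u′) ≡⟨ cong (λ k → M (Φ k (v i)) (f u′)) (toℕ-rotate q m) ⟩
    M (Φ (suc a % q) (v i)) (f u′)        ≈⟨ periodic⇒≈% ≈.setoid (λ k → M (Φ k (v i)) (f u′))
                                              (M-row-periodic (TF-fixed (TF-closed u′∈TF)) (v i)) (suc a) ⟩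
    M (Φ (suc a) (v i)) (f u′)            ≈⟨ M-invariant (Φ a (v i)) u′ ⟩
    M (Φ a (v i)) u′                      ∎
    where a = toℕ m
  Mtilde-ψ-invariant (inj₂ (i , m)) (inj₂ (j , m′)) = begin
    B (toℕ (rotate q m)) (toℕ (rotate q m′)) ≡⟨ cong₂ B (toℕ-rotate q m) (toℕ-rotate q m′) ⟩
    B (suc a % q) (suc b % q)               ≈⟨ periodic⇒≈% ≈.setoid (λ k → B k (suc b % q))
                                                 (λ k → B-entry-periodicˡ (v i) (v j) k (suc b % q)) (suc a) ⟩
    B (suc a) (suc b % q)                   ≈⟨ periodic⇒≈% ≈.setoid (B (suc a))
                                                 (B-entry-periodicʳ (v i) (v j) (suc a)) (suc b) ⟩
    B (suc a) (suc b)                       ≈⟨ B-entry-diagonal (v i) (v j) a b ⟩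
    B a b                                   ∎
    where
    B = B-entry (v i) (v j)
    a = toℕ m
    b = toℕ m′

proposition3p3 :
    ∀ {c ℓ} (R : CommutativeRing c ℓ) → let open CommutativeRing R in
    (n : ℕ) (G : Graph n) (φ : Permutation′ n) → IsAutomorphism G φ →
    (p N : ℕ) → Prime p → 0 < N → HasOrder (φ ⟨$⟩ʳ_) (p ^ N) →
    (M : Matrix R n n) → AutCompatible R G M →
    -- T_F = { v : |O_φ(v)| < p^N }, given as its indicator
    (TF : Fin n → Bool) →
    (∀ u → TF u ≡ true → ∃[ k ] (OrbitCard φ u k × k < p ^ N)) →
    (∀ u k → OrbitCard φ u k → k < p ^ N → TF u ≡ true) →
    -- T_0 = (v_1,…,v_r): an ordered transversal of the orbits of length p^N
    (r : ℕ) (v : Fin r → Fin n) →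
    (∀ i → OrbitCard φ (v i) (p ^ N)) →
    (∀ i j k → iter (φ ⟨$⟩ʳ_) k (v i) ≡ v j → i ≡ j) →
    (∀ w → OrbitCard φ w (p ^ N) → ∃[ i ] ∃[ k ] (iter (φ ⟨$⟩ʳ_) k (v i) ≡ w)) →
    Σ (Index TF r (p ^ (N ∸ 1)) ↔ Index TF r (p ^ (N ∸ 1))) λ ψ →
      HasOrder (Inverse.to ψ) (p ^ (N ∸ 1)) ×
      (∀ i j → Mtilde R φ p (p ^ (N ∸ 1)) TF r v M (Inverse.to ψ i) (Inverse.to ψ j)
               ≈ Mtilde R φ p (p ^ (N ∸ 1)) TF r v M i j)
proposition3p3 R n G φ aut p zero    p-prime () order M compatible TF TF⇒short short⇒TF r v _ _ meets
proposition3p3 R n G φ aut p (suc N) p-prime _  order M compatible TF TF⇒short short⇒TF r v _ _ meets =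
  hasOrder⇒↔ ψ-order , ψ-order ,
  Mtilde-ψ-invariant R φ M (compatible φ aut) p (p ^ N) (proj₁ (proj₂ order)) TF-closed TF-fixed r v
  where
  instance
    pᴺ≢0 : NonZero (p ^ N)
    pᴺ≢0 = m^n≢0 p N {{prime⇒nonZero p-prime}}

  TF-closed : ∀ {u} → TF u ≡ true → TF (φ ⟨$⟩ʳ u) ≡ true
  TF-closed {u} u∈TF with TF⇒short u u∈TF
  ... | k , card , k<pᴺ⁺¹ = short⇒TF _ k (orbitCard-φ φ p-prime N order card) k<pᴺ⁺¹

  TF-fixed : ∀ {u} → TF u ≡ true → iter (φ ⟨$⟩ʳ_) (p ^ N) u ≡ u
  TF-fixed {u} u∈TF with TF⇒short u u∈TF
  ... | k , card , k<pᴺ⁺¹ = short-orbit⇒fixed φ p-prime N order card k<pᴺ⁺¹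

  ψ-order : HasOrder (ψ φ TF-closed r (p ^ N)) (p ^ N)
  ψ-order = ψ-hasOrder φ TF-closed r (p ^ N) TF-fixed (fromℕ< (transversal-nonempty φ p-prime N order v meets))
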